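{- Let $G$ be a locally triangle-free graph in $W_2$ with $\alpha(G)\geqslant 3$. Let $(abc)$ be a triangle in $G$ such that $G_{ab}\neq\emptyset$, and let $A=N_G(a)\setminus N_G[b]$. If $A$ is not an independent set of $G$, then (1) the induced subgraph $G[A]$ consists of one edge and $\alpha(G)-2$ isolated vertices, and (2) $G_{ab}$ has $2(\alpha(G)-2)$ vertices.
   Context: Graphs are finite, simple, without isolated vertices. $\alpha(G)$ is the maximum size of an independent set; $G$ is well-covered if all maximal independent sets have equal size; a well-covered $G$ is in $W_2$ if removing any vertex leaves a well-covered graph with the same independence number. $N_G(S)$ is the set of vertices outside $S$ adjacent to some vertex in $S$, $N_G[S]=S\cup N_G(S)$, $G_S=G\setminus N_G[S]$, $G_v=G_{\{v\}}$, $G_{ab}=G_{\{a,b\}}$. $G$ is locally triangle-free if every $G_v$ is triangle-free. $G_{ab}\ne\emptyset$ means it has at least one vertex. -}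

module Defs where

open import Data.Nat using (ℕ; zero; suc; _≤_)
open import Data.Bool using (Bool; true; false; _∧_; _∨_; not)
open import Data.Fin using (Fin; zero; suc)
open import Data.Fin.Subset using (Subset; _∈_; _∉_; _⊆_; _∪_; ∁; ⁅_⁆; ∣_∣)
open import Data.Vec using (tabulate; lookup)
open import Data.Product using (Σ; ∃; _×_; _,_)
open import Data.Empty using (⊥)
open import Relation.Nullary using (¬_)
open import Relation.Binary.PropositionalEquality using (_≡_)

record Graph (n : ℕ) : Set where
  field
    adj        : Fin n → Fin n → Bool
    adj-sym    : ∀ u v → adj u v ≡ adj v u
    adj-irrefl : ∀ v → adj v v ≡ false
    noIsolated : ∀ v → ∃ λ w → adj v w ≡ true

module _ {n : ℕ} (G : Graph n) where
  open Graph G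

  Adj : Fin n → Fin n → Set
  Adj u v = adj u v ≡ true

  anyFin : ∀ {m} → (Fin m → Bool) → Bool
  anyFin {zero}  f = false
  anyFin {suc m} f = f zero ∨ anyFin (λ i → f (suc i))

  closedN : Subset n → Subset n
  closedN S = S ∪ tabulate (λ x → anyFin (λ s → lookup S s ∧ adj x s))

  -- vertex set of G_S = G ∖ N_G[S]
  G- : Subset n → Subset n
  G- S = ∁ (closedN S)

  Gv : Fin n → Subset n
  Gv v = G- ⁅ v ⁆

  Gab : Fin n → Fin n → Subset n
  Gab a b = G- (⁅ a ⁆ ∪ ⁅ b ⁆)

  V : Subset n
  V = tabulate (λ _ → true)

  V- : Fin n → Subset n
  V- v = ∁ ⁅ v ⁆

  -- Notions relative to the induced subgraph G[U] for a vertex set U.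
  Independent : Subset n → Subset n → Set
  Independent U S = S ⊆ U × (∀ x y → x ∈ S → y ∈ S → ¬ Adj x y)

  MaximalIndependent : Subset n → Subset n → Set
  MaximalIndependent U S =
    Independent U S × (∀ v → v ∈ U → v ∉ S → ¬ Independent U (S ∪ ⁅ v ⁆))

  IsAlpha : Subset n → ℕ → Set
  IsAlpha U k = (∃ λ S → Independent U S × ∣ S ∣ ≡ k)
              × (∀ S → Independent U S → ∣ S ∣ ≤ k)

  WellCovered : Subset n → Set
  WellCovered U = ∀ S T → MaximalIndependent U S → MaximalIndependent U T → ∣ S ∣ ≡ ∣ T ∣

  InW2 : Set
  InW2 = WellCovered V × (∀ v → WellCovered (V- v) × (∀ k → IsAlpha V k → IsAlpha (V- v) k))

  HasTriangleIn : Subset n → Set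
  HasTriangleIn U = Σ (Fin n) λ x → Σ (Fin n) λ y → Σ (Fin n) λ z →
    x ∈ U × y ∈ U × z ∈ U × Adj x y × Adj y z × Adj x z

  LocallyTriangleFree : Set
  LocallyTriangleFree = ∀ v → ¬ HasTriangleIn (Gv v)

  Aset : Fin n → Fin n → Subset n
  Aset a b = tabulate (λ x → adj a x ∧ not (lookup (closedN ⁅ b ⁆) x))

-- Write G_b for G ∖ N[b], A = N(a) ∖ N[b] and C = G_ab, so that the vertices of G_b
-- are split into A and C.  Local triangle-freeness makes G_b triangle-free, and makes every vertex
-- of C adjacent to an end of every edge inside A (else the edge and a form a triangle in G_v).
-- Membership in W₂ gives every vertex s of a maximum independent set I a private neighbour t,
-- adjacent to s but to no other vertex of I, and then I - s + t is again maximum.  Steering maximum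
-- independent sets by such swaps, a vertex of C forces first that every vertex of A has at most
-- one neighbour in A, and then that A spans a single edge xy.  Then W ∪ {b, x}, where
-- W = A ∖ {x, y}, is a maximal independent set, so |W| = α - 2; private neighbours match W with
-- the neighbours of y in C, and symmetrically with those of x, and these two classes partition C.

module Submission where

open import Defs
open import Data.Nat using (ℕ; zero; suc; _≤_; _<_; _+_; _*_; _∸_; s≤s)
open import Data.Nat.Properties using (+-suc; +-comm; +-identityʳ; suc-injective; ≤-refl; ≤-<-trans; <⇒≢; n≮n; m≤n+m; m∸n+n≡m)
open import Data.Nat.Induction using (<-wellFounded)
open import Induction.WellFounded using (Acc; acc)
open import Data.Bool using (Bool; true; false; _∧_; not)
import Data.Bool as Bool
open import Data.Bool.Properties using (∧-conicalˡ; ∧-conicalʳ)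
open import Data.Fin using (Fin; zero; suc)
open import Data.Fin.Properties using (_≟_; any?)
open import Data.Fin.Subset
  using (Subset; inside; outside; _∈_; _∉_; _⊆_; _∪_; _∩_; _─_; _-_; ∁; ⁅_⁆; ∣_∣)
open import Data.Fin.Subset.Properties
  using (x∈⁅x⁆; x∈⁅y⁆⇒x≡y; x∉⁅y⁆⇒x≢y; ∣⁅x⁆∣≡1; ∣⊥∣≡0; x∈p∪q⁺; x∈p∪q⁻; x∈p∩q⁺; x∈p∩q⁻;
         p─q⊆p; p─x─y≡p─y─x; x∈p∧x≢y⇒x∈p-y; x∈p⇒∣p-x∣<∣p∣; ⊆-antisym; Empty-unique; nonempty?; _∈?_;
         p⊆q⇒∣p∣≤∣q∣; x∈∁p⇒x∉p; x∉p⇒x∈∁p; x∉∁p⇒x∈p)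
open import Data.Vec using ([]; _∷_; here; there; tabulate; lookup)
open import Data.Vec.Properties using (lookup∘tabulate; lookup⇒[]=; []=⇒lookup)
open import Data.Product using (Σ; ∃; _×_; _,_; proj₁; proj₂)
open import Data.Sum using (_⊎_; inj₁; inj₂; [_,_]; map₁)
open import Data.Empty using (⊥; ⊥-elim)
open import Function using (_∘_)
open import Relation.Nullary using (¬_; Dec; yes; no; contradiction)
open import Relation.Nullary.Decidable using (_×-dec_; ¬?)
open import Relation.Binary.PropositionalEquality using (_≡_; _≢_; refl; sym; trans; cong; cong₂; subst)

-- Subsets of Fin n and counting

syllogismˡ : ∀ {A B : Set} → A ⊎ B → ¬ B → A
syllogismˡ (inj₁ a) _  = a
syllogismˡ (inj₂ b) ¬b = contradiction b ¬b

syllogismʳ : ∀ {A B : Set} → A ⊎ B → ¬ A → B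
syllogismʳ (inj₁ a) ¬a = contradiction a ¬a
syllogismʳ (inj₂ b) _  = b

x∈p─q⇒x∉q : ∀ {n} {x : Fin n} {p q : Subset n} → x ∈ p ─ q → x ∉ q
x∈p─q⇒x∉q {p = _ ∷ _} {outside ∷ _} here       ()
x∈p─q⇒x∉q {p = _ ∷ _} {inside ∷ _}  (there x∈) (there x∈q) = x∈p─q⇒x∉q x∈ x∈q
x∈p─q⇒x∉q {p = _ ∷ _} {outside ∷ _} (there x∈) (there x∈q) = x∈p─q⇒x∉q x∈ x∈q

module _ {n : ℕ} {p : Subset n} {x y : Fin n} where

  x∈p-y⇒x∈p : x ∈ p - y → x ∈ p
  x∈p-y⇒x∈p = p─q⊆p p ⁅ y ⁆

  x∈p-y⇒x≢y : x ∈ p - y → x ≢ y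
  x∈p-y⇒x≢y x∈ refl = x∈p─q⇒x∉q x∈ (x∈⁅x⁆ x)

  x∈p⇒x∈p∪⁅y⁆ : x ∈ p → x ∈ p ∪ ⁅ y ⁆
  x∈p⇒x∈p∪⁅y⁆ x∈p = x∈p∪q⁺ (inj₁ x∈p)

  x∈p∪⁅y⁆⁻ : x ∈ p ∪ ⁅ y ⁆ → x ∈ p ⊎ x ≡ y
  x∈p∪⁅y⁆⁻ x∈ with x∈p∪q⁻ p ⁅ y ⁆ x∈
  ... | inj₁ x∈p = inj₁ x∈p
  ... | inj₂ x∈y = inj₂ (x∈⁅y⁆⇒x≡y y x∈y)

x∈p∧x≢y⇒x∈p-y∪⁅z⁆ : ∀ {n} {p : Subset n} {x y z} → x ∈ p → x ≢ y → x ∈ (p - y) ∪ ⁅ z ⁆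
x∈p∧x≢y⇒x∈p-y∪⁅z⁆ x∈p x≢y = x∈p⇒x∈p∪⁅y⁆ (x∈p∧x≢y⇒x∈p-y x∈p x≢y)

y∈p∪⁅y⁆ : ∀ {n} {p : Subset n} {y} → y ∈ p ∪ ⁅ y ⁆
y∈p∪⁅y⁆ {y = y} = x∈p∪q⁺ (inj₂ (x∈⁅x⁆ y))

x∈tabulate⁺ : ∀ {n} {f : Fin n → Bool} {x} → f x ≡ true → x ∈ tabulate f
x∈tabulate⁺ {f = f} {x} fx = lookup⇒[]= x (tabulate f) (trans (lookup∘tabulate f x) fx)

x∈tabulate⁻ : ∀ {n} {f : Fin n → Bool} {x} → x ∈ tabulate f → f x ≡ true
x∈tabulate⁻ {f = f} {x} x∈ = trans (sym (lookup∘tabulate f x)) ([]=⇒lookup x∈)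

∣p∪q∣≡∣p∣+∣q∣ : ∀ {n} (p q : Subset n) → (∀ {x} → x ∈ p → x ∉ q) → ∣ p ∪ q ∣ ≡ ∣ p ∣ + ∣ q ∣
∣p∪q∣≡∣p∣+∣q∣ []            []            _ = refl
∣p∪q∣≡∣p∣+∣q∣ (inside ∷ p)  (inside ∷ q)  disjoint = contradiction here (disjoint here)
∣p∪q∣≡∣p∣+∣q∣ (inside ∷ p)  (outside ∷ q) disjoint =
  cong suc (∣p∪q∣≡∣p∣+∣q∣ p q λ x∈p x∈q → disjoint (there x∈p) (there x∈q))
∣p∪q∣≡∣p∣+∣q∣ (outside ∷ p) (inside ∷ q)  disjoint =
  trans (cong suc (∣p∪q∣≡∣p∣+∣q∣ p q λ x∈p x∈q → disjoint (there x∈p) (there x∈q))) (sym (+-suc ∣ p ∣ ∣ q ∣))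
∣p∪q∣≡∣p∣+∣q∣ (outside ∷ p) (outside ∷ q) disjoint =
  ∣p∪q∣≡∣p∣+∣q∣ p q λ x∈p x∈q → disjoint (there x∈p) (there x∈q)

x∉p⇒∣p∪⁅x⁆∣≡1+∣p∣ : ∀ {n} {p : Subset n} {x} → x ∉ p → ∣ p ∪ ⁅ x ⁆ ∣ ≡ suc ∣ p ∣
x∉p⇒∣p∪⁅x⁆∣≡1+∣p∣ {p = p} {x} x∉p = begin
  ∣ p ∪ ⁅ x ⁆ ∣    ≡⟨ ∣p∪q∣≡∣p∣+∣q∣ p ⁅ x ⁆ (λ y∈p y∈x → x∉p (subst (_∈ p) (x∈⁅y⁆⇒x≡y x y∈x) y∈p)) ⟩
  ∣ p ∣ + ∣ ⁅ x ⁆ ∣ ≡⟨ cong (∣ p ∣ +_) (∣⁅x⁆∣≡1 x) ⟩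
  ∣ p ∣ + 1        ≡⟨ +-comm ∣ p ∣ 1 ⟩
  suc ∣ p ∣        ∎
  where open Relation.Binary.PropositionalEquality.≡-Reasoning

x∈p⇒∣p∣≡1+∣p-x∣ : ∀ {n} {p : Subset n} {x} → x ∈ p → ∣ p ∣ ≡ suc ∣ p - x ∣
x∈p⇒∣p∣≡1+∣p-x∣ {p = p} {x} x∈p =
  trans (cong ∣_∣ p≡p-x∪x) (x∉p⇒∣p∪⁅x⁆∣≡1+∣p∣ {p = p - x} (λ x∈p-x → x∈p-y⇒x≢y x∈p-x refl))
  where
  p≡p-x∪x : p ≡ (p - x) ∪ ⁅ x ⁆
  p≡p-x∪x = ⊆-antisym ⊆-p-x∪x ⊇-p-x∪x
    where
    ⊆-p-x∪x : p ⊆ (p - x) ∪ ⁅ x ⁆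
    ⊆-p-x∪x {y} y∈p with y ≟ x
    ... | yes refl = y∈p∪⁅y⁆
    ... | no y≢x   = x∈p⇒x∈p∪⁅y⁆ (x∈p∧x≢y⇒x∈p-y y∈p y≢x)
    ⊇-p-x∪x : (p - x) ∪ ⁅ x ⁆ ⊆ p
    ⊇-p-x∪x y∈ with x∈p∪⁅y⁆⁻ y∈
    ... | inj₁ y∈p-x = x∈p-y⇒x∈p y∈p-x
    ... | inj₂ refl  = x∈p

nonempty⇒∣p∣≢0 : ∀ {n} {p : Subset n} {x} → x ∈ p → ∣ p ∣ ≢ 0
nonempty⇒∣p∣≢0 x∈p ∣p∣≡0 = contradiction (trans (sym ∣p∣≡0) (x∈p⇒∣p∣≡1+∣p-x∣ x∈p)) λ ()

record Matching {n} (R : Fin n → Fin n → Set) (p q : Subset n) : Set where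
  field
    partnerˡ : ∀ {v} → v ∈ p → ∃ λ w → w ∈ q × R v w
    partnerʳ : ∀ {w} → w ∈ q → ∃ λ v → v ∈ p × R v w
    uniqueˡ  : ∀ {v w w′} → v ∈ p → w ∈ q → w′ ∈ q → R v w → R v w′ → w ≡ w′
    uniqueʳ  : ∀ {v v′ w} → v ∈ p → v′ ∈ p → w ∈ q → R v w → R v′ w → v ≡ v′

module _ {n} {R : Fin n → Fin n → Set} where

  Matching-remove : ∀ {p q v w} → Matching R p q → v ∈ p → w ∈ q → R v w → Matching R (p - v) (q - w)
  Matching-remove {p} {q} {v} {w} M v∈p w∈q r = record
    { partnerˡ = λ v′∈ →
        let (w′ , w′∈q , r′) = partnerˡ (x∈p-y⇒x∈p v′∈) in
        w′ , x∈p∧x≢y⇒x∈p-y w′∈q (λ w′≡w → x∈p-y⇒x≢y v′∈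
                                (uniqueʳ (x∈p-y⇒x∈p v′∈) v∈p w∈q (subst (R _) w′≡w r′) r)) , r′
    ; partnerʳ = λ w′∈ →
        let (v′ , v′∈p , r′) = partnerʳ (x∈p-y⇒x∈p w′∈) in
        v′ , x∈p∧x≢y⇒x∈p-y v′∈p (λ v′≡v → x∈p-y⇒x≢y w′∈
                                (sym (uniqueˡ v∈p w∈q (x∈p-y⇒x∈p w′∈) r (subst (λ u → R u _) v′≡v r′)))) , r′
    ; uniqueˡ = λ v′∈ w₁∈ w₂∈ → uniqueˡ (x∈p-y⇒x∈p v′∈) (x∈p-y⇒x∈p w₁∈) (x∈p-y⇒x∈p w₂∈)
    ; uniqueʳ = λ v₁∈ v₂∈ w′∈ → uniqueʳ (x∈p-y⇒x∈p v₁∈) (x∈p-y⇒x∈p v₂∈) (x∈p-y⇒x∈p w′∈)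
    }
    where open Matching M

  Matching⇒∣p∣≡∣q∣ : ∀ {p q} → Matching R p q → ∣ p ∣ ≡ ∣ q ∣
  Matching⇒∣p∣≡∣q∣ M = sym (go _ refl M)
    where
    go : ∀ m {p q} → ∣ p ∣ ≡ m → Matching R p q → ∣ q ∣ ≡ m
    go zero {p} {q} ∣p∣≡0 M =
      trans (cong ∣_∣ (Empty-unique λ (w , w∈q) → let (v , v∈p , _) = Matching.partnerʳ M w∈q in
                         nonempty⇒∣p∣≢0 v∈p ∣p∣≡0))
            (∣⊥∣≡0 n)
    go (suc m) {p} {q} ∣p∣≡1+m M with nonempty? p
    ... | no p-empty = contradiction (trans (sym ∣p∣≡1+m) (trans (cong ∣_∣ (Empty-unique p-empty)) (∣⊥∣≡0 n))) λ ()
    ... | yes (v , v∈p) =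
      let (w , w∈q , r) = Matching.partnerˡ M v∈p in
      trans (x∈p⇒∣p∣≡1+∣p-x∣ w∈q)
            (cong suc (go m (suc-injective (trans (sym (x∈p⇒∣p∣≡1+∣p-x∣ v∈p)) ∣p∣≡1+m)) (Matching-remove M v∈p w∈q r)))

descend : ∀ {A : Set} (μ : A → ℕ) (P Q : A → Set) →
  (∀ x → P x → Q x ⊎ ∃ λ y → P y × μ y < μ x) → ∀ x → P x → ∃ λ y → P y × Q y
descend μ P Q step x Px = go x Px (<-wellFounded (μ x))
  where
  go : ∀ x → P x → Acc _<_ (μ x) → ∃ λ y → P y × Q y
  go x Px (acc rec) with step x Px
  ... | inj₁ Qx             = x , Px , Qx
  ... | inj₂ (y , Py , y<x) = go y Py (rec y<x)

module GraphProperties {n : ℕ} (G : Graph n) where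
  open Graph G

  Adj-sym : ∀ {x y} → Adj G x y → Adj G y x
  Adj-sym {x} {y} xy = trans (adj-sym y x) xy

  Adj-irrefl : ∀ {x} → ¬ Adj G x x
  Adj-irrefl {x} xx with () ← trans (sym xx) (adj-irrefl x)

  Adj⇒≢ : ∀ {x y} → Adj G x y → x ≢ y
  Adj⇒≢ xy refl = Adj-irrefl xy

  Adj? : ∀ x y → Dec (Adj G x y)
  Adj? x y = adj x y Bool.≟ true

  ∈V : ∀ {x} → x ∈ V G
  ∈V = x∈tabulate⁺ refl

  Nbhd : Fin n → Subset n
  Nbhd v = tabulate (adj v)

  ∈Nbhd⁺ : ∀ {v s} → Adj G v s → s ∈ Nbhd v
  ∈Nbhd⁺ = x∈tabulate⁺

  ∈Nbhd⁻ : ∀ {v s} → s ∈ Nbhd v → Adj G v s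
  ∈Nbhd⁻ = x∈tabulate⁻

  anyFin⁺ : ∀ {m} (f : Fin m → Bool) i → f i ≡ true → anyFin G f ≡ true
  anyFin⁺ f zero    fi rewrite fi = refl
  anyFin⁺ f (suc i) fi with f zero
  ... | true  = refl
  ... | false = anyFin⁺ (λ j → f (suc j)) i fi

  anyFin⁻ : ∀ {m} (f : Fin m → Bool) → anyFin G f ≡ true → ∃ λ i → f i ≡ true
  anyFin⁻ {suc m} f any with f zero in f0
  ... | true  = zero , f0
  ... | false = let (i , fi) = anyFin⁻ (λ j → f (suc j)) any in suc i , fi

  ∈closedN⁺ : ∀ {S x} → x ∈ S ⊎ (∃ λ s → s ∈ S × Adj G x s) → x ∈ closedN G S
  ∈closedN⁺ (inj₁ x∈S)            = x∈p∪q⁺ (inj₁ x∈S)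
  ∈closedN⁺ {S} (inj₂ (s , s∈S , xs)) =
    x∈p∪q⁺ (inj₂ (x∈tabulate⁺ (anyFin⁺ _ s (subst (λ b → (b ∧ _) ≡ true) (sym ([]=⇒lookup s∈S)) xs))))

  ∈closedN⁻ : ∀ {S x} → x ∈ closedN G S → x ∈ S ⊎ (∃ λ s → s ∈ S × Adj G x s)
  ∈closedN⁻ {S} {x} x∈ with x∈p∪q⁻ S _ x∈
  ... | inj₁ x∈S = inj₁ x∈S
  ... | inj₂ x∈N =
    let (s , Ss∧xs) = anyFin⁻ _ (x∈tabulate⁻ x∈N) in
    inj₂ (s , lookup⇒[]= s S (∧-conicalˡ _ _ Ss∧xs) , ∧-conicalʳ _ _ Ss∧xs)

  Undominated : Subset n → Fin n → Set
  Undominated S z = z ∉ S × (∀ {s} → s ∈ S → ¬ Adj G z s)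

  ∈G-⁺ : ∀ {S z} → Undominated S z → z ∈ G- G S
  ∈G-⁺ (z∉S , z≁S) = x∉p⇒x∈∁p λ z∈ → [ z∉S , (λ (s , s∈S , zs) → z≁S s∈S zs) ] (∈closedN⁻ z∈)

  ∈G-⁻ : ∀ {S z} → z ∈ G- G S → Undominated S z
  ∈G-⁻ z∈ = (λ z∈S → x∈∁p⇒x∉p z∈ (∈closedN⁺ (inj₁ z∈S))) ,
            (λ s∈S zs → x∈∁p⇒x∉p z∈ (∈closedN⁺ (inj₂ (_ , s∈S , zs))))

  Undominated-⊆ : ∀ {S T z} → T ⊆ S → Undominated S z → Undominated T z
  Undominated-⊆ T⊆S (z∉S , z≁S) = z∉S ∘ T⊆S , z≁S ∘ T⊆S

  Undominated-∪⁻ : ∀ {S T z} → Undominated (S ∪ T) z → Undominated S z × Undominated T z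
  Undominated-∪⁻ (z∉ , z≁) =
    (z∉ ∘ x∈p∪q⁺ ∘ inj₁ , z≁ ∘ x∈p∪q⁺ ∘ inj₁) , (z∉ ∘ x∈p∪q⁺ ∘ inj₂ , z≁ ∘ x∈p∪q⁺ ∘ inj₂)

  Undominated-∪⁺ : ∀ {S T z} → Undominated S z → Undominated T z → Undominated (S ∪ T) z
  Undominated-∪⁺ {S} {T} (z∉S , z≁S) (z∉T , z≁T) =
    (λ z∈ → [ z∉S , z∉T ] (x∈p∪q⁻ S T z∈)) ,
    (λ s∈ → [ z≁S , z≁T ] (x∈p∪q⁻ S T s∈))

  Undominated-⁅⁆⁺ : ∀ {v z} → z ≢ v → ¬ Adj G z v → Undominated ⁅ v ⁆ z
  Undominated-⁅⁆⁺ {v} z≢v z≁v =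
    z≢v ∘ x∈⁅y⁆⇒x≡y v , λ s∈v → subst (λ s → ¬ Adj G _ s) (sym (x∈⁅y⁆⇒x≡y v s∈v)) z≁v

  Undominated-⁅⁆⁻ : ∀ {v z} → Undominated ⁅ v ⁆ z → z ≢ v × ¬ Adj G z v
  Undominated-⁅⁆⁻ {v} (z∉v , z≁v) = x∉⁅y⁆⇒x≢y z∉v , z≁v (x∈⁅x⁆ v)

  ∈Gv⁺ : ∀ {v z} → z ≢ v → ¬ Adj G z v → z ∈ Gv G v
  ∈Gv⁺ z≢v z≁v = ∈G-⁺ (Undominated-⁅⁆⁺ z≢v z≁v)

  ∈Aset⁺ : ∀ {a b x} → Adj G a x → Undominated ⁅ b ⁆ x → x ∈ Aset G a b
  ∈Aset⁺ {a} {b} {x} ax x∈Gb =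
    x∈tabulate⁺ (cong₂ (λ u w → u ∧ not w) ax (x∉p⇒lookup≡false (x∈∁p⇒x∉p (∈G-⁺ x∈Gb))))
    where
    x∉p⇒lookup≡false : ∀ {p : Subset n} → x ∉ p → lookup p x ≡ false
    x∉p⇒lookup≡false {p} x∉p with lookup p x in eq
    ... | true  = contradiction (lookup⇒[]= x p eq) x∉p
    ... | false = refl

  ∈Aset⁻ : ∀ {a b x} → x ∈ Aset G a b → Adj G a x × Undominated ⁅ b ⁆ x
  ∈Aset⁻ x∈ with x∈tabulate⁻ x∈
  ... | ax∧x∉N[b] = ∧-conicalˡ _ _ ax∧x∉N[b] , ∈G-⁻ (x∉p⇒x∈∁p λ x∈N[b] →
          contradiction (subst (λ u → not u ≡ true) ([]=⇒lookup x∈N[b]) (∧-conicalʳ _ _ ax∧x∉N[b])) λ ())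

  Undominated-∪⁅⁆ : ∀ {S w z} → Undominated S w → w ≢ z → ¬ Adj G w z → Undominated (S ∪ ⁅ z ⁆) w
  Undominated-∪⁅⁆ uw w≢z w≁z = Undominated-∪⁺ uw (Undominated-⁅⁆⁺ w≢z w≁z)

  Indep : Subset n → Set
  Indep S = ∀ {x y} → x ∈ S → y ∈ S → ¬ Adj G x y

  Indep-⊆ : ∀ {S T} → T ⊆ S → Indep S → Indep T
  Indep-⊆ T⊆S indS x∈T y∈T = indS (T⊆S x∈T) (T⊆S y∈T)

  Indep-∪⁅⁆ : ∀ {S z} → Indep S → Undominated S z → Indep (S ∪ ⁅ z ⁆)
  Indep-∪⁅⁆ indS (_ , z≁S) x∈ y∈ with x∈p∪⁅y⁆⁻ x∈ | x∈p∪⁅y⁆⁻ y∈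
  ... | inj₁ x∈S | inj₁ y∈S = indS x∈S y∈S
  ... | inj₁ x∈S | inj₂ refl = z≁S x∈S ∘ Adj-sym
  ... | inj₂ refl | inj₁ y∈S = z≁S y∈S
  ... | inj₂ refl | inj₂ refl = Adj-irrefl

  Indep-⁅⁆ : ∀ {v} → Indep ⁅ v ⁆
  Indep-⁅⁆ {v} x∈ y∈ with x∈⁅y⁆⇒x≡y v x∈ | x∈⁅y⁆⇒x≡y v y∈
  ... | refl | refl = Adj-irrefl

  Indep⇒Independent : ∀ {S} → Indep S → Independent G (V G) S
  Indep⇒Independent indS = (λ _ → ∈V) , λ _ _ → indS

  Dominating : Subset n → Subset n → Set
  Dominating U S = ∀ {z} → z ∈ U → z ∉ S → ∃ λ s → s ∈ S × Adj G z s

  dominated? : ∀ S z → Dec (∃ λ s → s ∈ S × Adj G z s)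
  dominated? S z = any? λ s → s ∈? S ×-dec Adj? z s

  module _ {U : Subset n} {k : ℕ} (αU : IsAlpha G U k) (wcU : WellCovered G U) where

    Dominating⇒∣S∣≡α : ∀ {S} → Independent G U S → Dominating U S → ∣ S ∣ ≡ k
    Dominating⇒∣S∣≡α {S} indS dom = trans (wcU S S₀ (indS , maximal) (indS₀ , maximal₀)) ∣S₀∣≡k
      where
      S₀ = proj₁ (proj₁ αU)
      indS₀ = proj₁ (proj₂ (proj₁ αU))
      ∣S₀∣≡k = proj₂ (proj₂ (proj₁ αU))
      maximal : ∀ v → v ∈ U → v ∉ S → ¬ Independent G U (S ∪ ⁅ v ⁆)
      maximal v v∈U v∉S (_ , ind) =
        let (s , s∈S , vs) = dom v∈U v∉S in ind v s y∈p∪⁅y⁆ (x∈p⇒x∈p∪⁅y⁆ s∈S) vs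
      maximal₀ : ∀ v → v ∈ U → v ∉ S₀ → ¬ Independent G U (S₀ ∪ ⁅ v ⁆)
      maximal₀ v v∈U v∉S₀ ind =
        n≮n k (subst (_≤ k) (trans (x∉p⇒∣p∪⁅x⁆∣≡1+∣p∣ v∉S₀) (cong suc ∣S₀∣≡k)) (proj₂ αU _ ind))

    ∣S∣<α⇒undominated : ∀ {S} → Independent G U S → ∣ S ∣ < k → ∃ λ z → z ∈ U × Undominated S z
    ∣S∣<α⇒undominated {S} indS ∣S∣<k with any? (λ z → z ∈? U ×-dec (¬? (z ∈? S) ×-dec ¬? (dominated? S z)))
    ... | yes (z , z∈U , z∉S , ¬dom) = z , z∈U , z∉S , λ s∈S zs → ¬dom (_ , s∈S , zs)
    ... | no none = contradiction (Dominating⇒∣S∣≡α indS dominating) (<⇒≢ ∣S∣<k)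
      where
      dominating : Dominating U S
      dominating {z} z∈U z∉S with dominated? S z
      ... | yes dom = dom
      ... | no ¬dom = contradiction (z , z∈U , z∉S , ¬dom) none

-- Graphs in W₂

module W2 {n : ℕ} (G : Graph n) {k : ℕ} (α : IsAlpha G (V G) k) (w2 : InW2 G) where

  open GraphProperties G

  Maximum : Subset n → Set
  Maximum I = Indep I × ∣ I ∣ ≡ k

  ∣Indep∣≤α : ∀ {S} → Indep S → ∣ S ∣ ≤ k
  ∣Indep∣≤α {S} indS = proj₂ α S (Indep⇒Independent indS)

  Undominated⇒∣S∣<α : ∀ {S z} → Indep S → Undominated S z → ∣ S ∣ < k
  Undominated⇒∣S∣<α indS uz = subst (_≤ k) (x∉p⇒∣p∪⁅x⁆∣≡1+∣p∣ (proj₁ uz)) (∣Indep∣≤α (Indep-∪⁅⁆ indS uz))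

  Maximum⇒¬Undominated : ∀ {I z} → Maximum I → ¬ Undominated I z
  Maximum⇒¬Undominated (indI , ∣I∣≡k) uz = <⇒≢ (Undominated⇒∣S∣<α indI uz) ∣I∣≡k

  extend : ∀ {S} → Indep S → ∃ λ I → Maximum I × S ⊆ I
  extend {S} indS = go (k ∸ ∣ S ∣) indS (m∸n+n≡m (∣Indep∣≤α indS))
    where
    go : ∀ m {S} → Indep S → m + ∣ S ∣ ≡ k → ∃ λ I → Maximum I × S ⊆ I
    go zero    {S} indS ∣S∣≡k = S , (indS , ∣S∣≡k) , λ x∈ → x∈
    go (suc m) {S} indS m+1+∣S∣≡k =
      let (z , _ , uz) = ∣S∣<α⇒undominated α (proj₁ w2) (Indep⇒Independent indS)
                           (subst (∣ S ∣ <_) m+1+∣S∣≡k (s≤s (m≤n+m ∣ S ∣ m)))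
          (I , maxI , S∪z⊆I) = go m (Indep-∪⁅⁆ indS uz)
                                 (trans (cong (m +_) (x∉p⇒∣p∪⁅x⁆∣≡1+∣p∣ (proj₁ uz))) (trans (+-suc m ∣ S ∣) m+1+∣S∣≡k))
      in I , maxI , S∪z⊆I ∘ x∈p⇒x∈p∪⁅y⁆

  undominated-adjacent : ∀ {S z w} → Indep S → suc ∣ S ∣ ≡ k →
    Undominated S z → Undominated S w → z ≢ w → Adj G z w
  undominated-adjacent {S} {z} {w} indS 1+∣S∣≡k uz uw z≢w with Adj? z w
  ... | yes zw = zw
  ... | no z≁w = ⊥-elim (Maximum⇒¬Undominated
    (Indep-∪⁅⁆ indS uz , trans (x∉p⇒∣p∪⁅x⁆∣≡1+∣p∣ (proj₁ uz)) 1+∣S∣≡k)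
    (Undominated-∪⁅⁆ uw (z≢w ∘ sym) (z≁w ∘ Adj-sym)))

  undominated-partner : ∀ {S z} → Indep S → suc ∣ S ∣ ≡ k → Undominated S z →
    ∃ λ z′ → Undominated S z′ × Adj G z z′
  undominated-partner {S} {z} indS 1+∣S∣≡k uz =
    let (wc-z , α-z) = proj₂ w2 z
        (z′ , z′∈V-z , uz′) = ∣S∣<α⇒undominated (α-z k α) wc-z (S⊆V-z , λ _ _ → indS)
                                (subst (∣ S ∣ <_) 1+∣S∣≡k ≤-refl)
    in z′ , uz′ , undominated-adjacent indS 1+∣S∣≡k uz uz′
                    (λ z≡z′ → x∈∁p⇒x∉p z′∈V-z (subst (_∈ ⁅ z ⁆) z≡z′ (x∈⁅x⁆ z)))
    where
    S⊆V-z : S ⊆ V- G z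
    S⊆V-z s∈S = x∉p⇒x∈∁p λ s∈z → proj₁ uz (subst (_∈ S) (x∈⁅y⁆⇒x≡y z s∈z) s∈S)

  removed-undominated : ∀ {I s} → Indep I → s ∈ I → Undominated (I - s) s
  removed-undominated indI s∈I = (λ s∈I-s → x∈p-y⇒x≢y s∈I-s refl) , λ r∈I-s → indI s∈I (x∈p-y⇒x∈p r∈I-s)

  private-neighbour : ∀ {I s} → Maximum I → s ∈ I → ∃ λ t → Undominated (I - s) t × Adj G s t
  private-neighbour (indI , ∣I∣≡k) s∈I =
    undominated-partner (Indep-⊆ x∈p-y⇒x∈p indI) (trans (sym (x∈p⇒∣p∣≡1+∣p-x∣ s∈I)) ∣I∣≡k)
      (removed-undominated indI s∈I)

  swap : ∀ {I s t} → Maximum I → s ∈ I → Undominated (I - s) t → Maximum ((I - s) ∪ ⁅ t ⁆)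
  swap (indI , ∣I∣≡k) s∈I ut =
    Indep-∪⁅⁆ (Indep-⊆ x∈p-y⇒x∈p indI) ut ,
    trans (x∉p⇒∣p∪⁅x⁆∣≡1+∣p∣ (proj₁ ut)) (trans (sym (x∈p⇒∣p∣≡1+∣p-x∣ s∈I)) ∣I∣≡k)

  swap-out : ∀ (B : Subset n) (P : Subset n → Set) →
    (∀ {I s} → Maximum I → P I → s ∈ I → s ∈ B →
       ∃ λ t → t ∉ B × Undominated (I - s) t × P ((I - s) ∪ ⁅ t ⁆)) →
    ∀ {I} → Maximum I → P I → ∃ λ J → (Maximum J × P J) × (∀ {s} → s ∈ J → s ∉ B)
  swap-out B P exchange {I} maxI PI =
    descend (λ I → ∣ I ∩ B ∣) (λ I → Maximum I × P I) (λ I → ∀ {s} → s ∈ I → s ∉ B) step I (maxI , PI)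
    where
    step : ∀ I → Maximum I × P I →
      (∀ {s} → s ∈ I → s ∉ B) ⊎ ∃ λ J → (Maximum J × P J) × ∣ J ∩ B ∣ < ∣ I ∩ B ∣
    step I (maxI , PI) with nonempty? (I ∩ B)
    ... | no none = inj₁ λ s∈I s∈B → none (_ , x∈p∩q⁺ (s∈I , s∈B))
    ... | yes (s , s∈I∩B) =
      let (s∈I , s∈B) = x∈p∩q⁻ I B s∈I∩B
          (t , t∉B , ut , PJ) = exchange maxI PI s∈I s∈B
      in inj₂ ((I - s) ∪ ⁅ t ⁆ , (swap maxI s∈I ut , PJ) ,
               ≤-<-trans (p⊆q⇒∣p∣≤∣q∣ (J∩B⊆I∩B-s t∉B)) (x∈p⇒∣p-x∣<∣p∣ s∈I∩B))
      where
      J∩B⊆I∩B-s : ∀ {t} → t ∉ B → ((I - s) ∪ ⁅ t ⁆) ∩ B ⊆ (I ∩ B) - s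
      J∩B⊆I∩B-s {t} t∉B x∈ with x∈p∩q⁻ ((I - s) ∪ ⁅ t ⁆) B x∈
      ... | x∈J , x∈B with x∈p∪⁅y⁆⁻ x∈J
      ...   | inj₁ x∈I-s = x∈p∧x≢y⇒x∈p-y (x∈p∩q⁺ (x∈p-y⇒x∈p x∈I-s , x∈B)) (x∈p-y⇒x≢y x∈I-s)
      ...   | inj₂ refl  = contradiction x∈B t∉B

  no-three-undominated : LocallyTriangleFree G → ∀ {S s x y z} → Indep S → suc ∣ S ∣ ≡ k → s ∈ S →
    Undominated S x → Undominated S y → Undominated S z → x ≢ y → y ≢ z → x ≢ z → ⊥
  no-three-undominated ltf {S} {s} indS 1+∣S∣≡k s∈S ux uy uz x≢y y≢z x≢z =
    ltf s (_ , _ , _ , ∈Gs ux , ∈Gs uy , ∈Gs uz ,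
           adjacent ux uy x≢y , adjacent uy uz y≢z , adjacent ux uz x≢z)
    where
    ∈Gs : ∀ {u} → Undominated S u → u ∈ Gv G s
    ∈Gs (u∉S , u≁S) = ∈Gv⁺ (λ { refl → u∉S s∈S }) (u≁S s∈S)
    adjacent : ∀ {u w} → Undominated S u → Undominated S w → u ≢ w → Adj G u w
    adjacent = undominated-adjacent indS 1+∣S∣≡k

-- The neighbourhood of the edge ab

module AroundEdge {n : ℕ} (G : Graph n) {k : ℕ} (α : IsAlpha G (V G) k) (ltf : LocallyTriangleFree G) (w2 : InW2 G)
  {a b : Fin n} (ab : Adj G a b) {v₀ : Fin n} (v₀∈Gab : v₀ ∈ Gab G a b) where

  open GraphProperties G
  open W2 G α w2

  InGb : Fin n → Set
  InGb z = z ≢ b × ¬ Adj G z b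

  InA : Fin n → Set
  InA z = Adj G a z × InGb z

  InC : Fin n → Set
  InC z = InGb z × ¬ Adj G z a

  InA⇒∈Aset : ∀ {z} → InA z → z ∈ Aset G a b
  InA⇒∈Aset (az , z≢b , z≁b) = ∈Aset⁺ az (Undominated-⁅⁆⁺ z≢b z≁b)

  ∈Aset⇒InA : ∀ {z} → z ∈ Aset G a b → InA z
  ∈Aset⇒InA z∈ = let (az , uz) = ∈Aset⁻ z∈ in az , Undominated-⁅⁆⁻ uz

  ∈Gab⇒InC : ∀ {z} → z ∈ Gab G a b → InC z
  ∈Gab⇒InC z∈ = let (ua , ub) = Undominated-∪⁻ (∈G-⁻ z∈) in
                Undominated-⁅⁆⁻ ub , proj₂ (Undominated-⁅⁆⁻ ua)

  InC⇒∈Gab : ∀ {z} → InC z → z ∈ Gab G a b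
  InC⇒∈Gab ((z≢b , z≁b) , z≁a) =
    ∈G-⁺ (Undominated-∪⁺ (Undominated-⁅⁆⁺ (λ { refl → z≁b ab }) z≁a) (Undominated-⁅⁆⁺ z≢b z≁b))

  InGb⇒InA⊎InC : ∀ {z} → InGb z → InA z ⊎ InC z
  InGb⇒InA⊎InC {z} z∈Gb with Adj? a z
  ... | yes az = inj₁ (az , z∈Gb)
  ... | no a≁z = inj₂ (z∈Gb , a≁z ∘ Adj-sym)

  InA×InC⇒⊥ : ∀ {z} → InA z → InC z → ⊥
  InA×InC⇒⊥ (az , _) (_ , z≁a) = z≁a (Adj-sym az)

  InA? : ∀ z → Dec (InA z)
  InA? z = Adj? a z ×-dec (¬? (z ≟ b) ×-dec ¬? (Adj? z b))

  v₀∈C : InC v₀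
  v₀∈C = ∈Gab⇒InC v₀∈Gab

  Gb-triangle-free : ∀ {u v w} → InGb u → InGb v → InGb w → Adj G u v → Adj G v w → Adj G u w → ⊥
  Gb-triangle-free (u≢b , u≁b) (v≢b , v≁b) (w≢b , w≁b) uv vw uw =
    ltf b (_ , _ , _ , ∈Gv⁺ u≢b u≁b , ∈Gv⁺ v≢b v≁b , ∈Gv⁺ w≢b w≁b , uv , vw , uw)

  C-dominates-A-edges : ∀ {v u w} → InC v → InA u → InA w → Adj G u w → Adj G v u ⊎ Adj G v w
  C-dominates-A-edges {v} {u} {w} ((_ , v≁b) , v≁a) (au , _) (aw , _) uw with Adj? v u | Adj? v w
  ... | yes vu | _      = inj₁ vu
  ... | no _   | yes vw = inj₂ vw
  ... | no v≁u | no v≁w = ⊥-elim (ltf v (a , u , w ,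
          ∈Gv⁺ (λ { refl → v≁b ab }) (v≁a ∘ Adj-sym) ,
          ∈Gv⁺ (λ { refl → v≁a (Adj-sym au) }) (v≁u ∘ Adj-sym) ,
          ∈Gv⁺ (λ { refl → v≁a (Adj-sym aw) }) (v≁w ∘ Adj-sym) ,
          au , uw , aw))

  member⇒InGb : ∀ {S s} → Indep S → b ∈ S → s ∈ S → s ≢ b → InGb s
  member⇒InGb indS b∈S s∈S s≢b = s≢b , indS s∈S b∈S

  undominated⇒InGb : ∀ {S t} → b ∈ S → Undominated S t → InGb t
  undominated⇒InGb b∈S (t∉S , t≁S) = (λ { refl → t∉S b∈S }) , t≁S b∈S

  private-neighbour-in-Gb : ∀ {I s} → Maximum I → b ∈ I → s ∈ I → s ≢ b →
    ∃ λ t → InGb t × Undominated (I - s) t × Adj G s t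
  private-neighbour-in-Gb maxI b∈I s∈I s≢b =
    let (t , ut , st) = private-neighbour maxI s∈I in
    t , undominated⇒InGb (x∈p∧x≢y⇒x∈p-y b∈I (s≢b ∘ sym)) ut , ut , st

  v₀∈Gb : InGb v₀
  v₀∈Gb = proj₁ v₀∈C

  no-A-pentagon : ∀ {x₀ p p′ q′ q} → InA x₀ → InA p → InA p′ → InA q′ → InA q →
    Adj G x₀ p → Adj G p p′ → Adj G p′ q′ → Adj G q′ q → Adj G q x₀ → ⊥
  no-A-pentagon {x₀} x₀A@(_ , x₀∈Gb) pA@(_ , p∈Gb) p′A@(_ , p′∈Gb) q′A@(_ , q′∈Gb) qA@(_ , q∈Gb)
                x₀p pp′ p′q′ q′q qx₀ with Adj? v₀ x₀
  ... | yes v₀x₀ = Gb-triangle-free v₀∈Gb p′∈Gb q′∈Gb v₀p′ p′q′ v₀q′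
    where
    v₀p′ = syllogismʳ (C-dominates-A-edges v₀∈C pA p′A pp′) (Gb-triangle-free v₀∈Gb x₀∈Gb p∈Gb v₀x₀ x₀p)
    v₀q′ = syllogismˡ (C-dominates-A-edges v₀∈C q′A qA q′q) λ v₀q → Gb-triangle-free v₀∈Gb q∈Gb x₀∈Gb v₀q qx₀ v₀x₀
  ... | no v₀≁x₀ with C-dominates-A-edges v₀∈C p′A q′A p′q′
  ...   | inj₁ v₀p′ = Gb-triangle-free v₀∈Gb p∈Gb p′∈Gb v₀p pp′ v₀p′
    where v₀p = syllogismʳ (C-dominates-A-edges v₀∈C x₀A pA x₀p) v₀≁x₀
  ...   | inj₂ v₀q′ = Gb-triangle-free v₀∈Gb q′∈Gb q∈Gb v₀q′ q′q v₀q
    where v₀q = syllogismˡ (C-dominates-A-edges v₀∈C qA x₀A qx₀) v₀≁x₀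

  clear-cherry : ∀ {x₀ p q} → InA x₀ → InA p → InA q → Adj G x₀ p → Adj G x₀ q → p ≢ q →
    ∃ λ I → Maximum I × (b ∈ I × p ∈ I × q ∈ I) × (∀ {s} → s ∈ I → Adj G x₀ s → s ≡ p ⊎ s ≡ q)
  clear-cherry {x₀} {p} {q} (_ , x₀∈Gb) (_ , p≢b , p≁b) (_ , q≢b , q≁b) x₀p x₀q p≢q =
    let (I₀ , maxI₀ , J⊆I₀) = extend indJ
        (I , (maxI , b∈I , p∈I , q∈I) , I∩B≡∅) =
          swap-out B P exchange maxI₀ (J⊆I₀ (x∈p⇒x∈p∪⁅y⁆ (x∈p⇒x∈p∪⁅y⁆ (x∈⁅x⁆ b))) ,
                                      J⊆I₀ (x∈p⇒x∈p∪⁅y⁆ y∈p∪⁅y⁆) , J⊆I₀ y∈p∪⁅y⁆)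
    in I , maxI , (b∈I , p∈I , q∈I) , λ s∈I x₀s → only-p-q (I∩B≡∅ s∈I) x₀s
    where
    indJ : Indep ((⁅ b ⁆ ∪ ⁅ p ⁆) ∪ ⁅ q ⁆)
    indJ = Indep-∪⁅⁆ (Indep-∪⁅⁆ Indep-⁅⁆ (Undominated-⁅⁆⁺ p≢b p≁b))
             (Undominated-∪⁅⁆ (Undominated-⁅⁆⁺ q≢b q≁b) (p≢q ∘ sym)
               λ qp → Gb-triangle-free x₀∈Gb (p≢b , p≁b) (q≢b , q≁b) x₀p (Adj-sym qp) x₀q)
    B = Nbhd x₀ - p - q
    P : Subset n → Set
    P I = b ∈ I × p ∈ I × q ∈ I
    exchange : ∀ {I s} → Maximum I → P I → s ∈ I → s ∈ B →
      ∃ λ t → t ∉ B × Undominated (I - s) t × P ((I - s) ∪ ⁅ t ⁆)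
    exchange maxI (b∈I , p∈I , q∈I) s∈I s∈B =
      let s≢q = x∈p-y⇒x≢y s∈B
          s≢p = x∈p-y⇒x≢y (x∈p-y⇒x∈p s∈B)
          x₀s = ∈Nbhd⁻ (x∈p-y⇒x∈p (x∈p-y⇒x∈p s∈B))
          s≢b = λ { refl → proj₂ x₀∈Gb x₀s }
          (t , t∈Gb , ut , st) = private-neighbour-in-Gb maxI b∈I s∈I s≢b
      in t ,
         (λ t∈B → Gb-triangle-free x₀∈Gb (member⇒InGb (proj₁ maxI) b∈I s∈I s≢b) t∈Gb x₀s st
                    (∈Nbhd⁻ (x∈p-y⇒x∈p (x∈p-y⇒x∈p t∈B)))) ,
         ut ,
         x∈p∧x≢y⇒x∈p-y∪⁅z⁆ b∈I (s≢b ∘ sym) , x∈p∧x≢y⇒x∈p-y∪⁅z⁆ p∈I (s≢p ∘ sym) , x∈p∧x≢y⇒x∈p-y∪⁅z⁆ q∈I (s≢q ∘ sym)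
    only-p-q : ∀ {s} → s ∉ B → Adj G x₀ s → s ≡ p ⊎ s ≡ q
    only-p-q {s} s∉B x₀s with s ≟ p | s ≟ q
    ... | yes s≡p | _       = inj₁ s≡p
    ... | no _    | yes s≡q = inj₂ s≡q
    ... | no s≢p  | no s≢q  = contradiction (x∈p∧x≢y⇒x∈p-y (x∈p∧x≢y⇒x∈p-y (∈Nbhd⁺ x₀s) s≢p) s≢q) s∉B

  private-neighbour-of-cherry-leaf : ∀ {x₀ p q I} → InA x₀ → InA p → InA q → Adj G x₀ p → Adj G x₀ q → p ≢ q →
    Maximum I → b ∈ I → p ∈ I → q ∈ I →
    ∃ λ p′ → InA p′ × Undominated (I - p) p′ × Adj G p p′ × ¬ Adj G p′ x₀
  private-neighbour-of-cherry-leaf {x₀} x₀A@(_ , x₀∈Gb) (_ , p∈Gb) qA x₀p x₀q p≢q maxI b∈I p∈I q∈I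
    with private-neighbour-in-Gb maxI b∈I p∈I (proj₁ p∈Gb)
  ... | p′ , p′∈Gb , up′ , pp′ = p′ , p′A , up′ , pp′ , p′≁x₀
    where
    p′≁x₀ : ¬ Adj G p′ x₀
    p′≁x₀ p′x₀ = Gb-triangle-free x₀∈Gb p∈Gb p′∈Gb x₀p pp′ (Adj-sym p′x₀)
    p′A : InA p′
    p′A = syllogismˡ (InGb⇒InA⊎InC p′∈Gb) λ p′C →
            [ p′≁x₀ , proj₂ up′ (x∈p∧x≢y⇒x∈p-y q∈I (p≢q ∘ sym)) ] (C-dominates-A-edges p′C x₀A qA x₀q)

  -- The private neighbours p′ and q′ of p and q close the pentagon x₀ p p′ q′ q: both are
  -- undominated by the (k - 1)-set I - p - q + x₀, hence adjacent.
  no-cleared-cherry : ∀ {x₀ p q I} → InA x₀ → InA p → InA q → Adj G x₀ p → Adj G x₀ q → p ≢ q →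
    Maximum I → b ∈ I → p ∈ I → q ∈ I → (∀ {s} → s ∈ I → Adj G x₀ s → s ≡ p ⊎ s ≡ q) → ⊥
  no-cleared-cherry {x₀} {p} {q} {I} x₀A pA qA x₀p x₀q p≢q maxI@(indI , ∣I∣≡k) b∈I p∈I q∈I x₀-only
    with private-neighbour-of-cherry-leaf x₀A pA qA x₀p x₀q p≢q maxI b∈I p∈I q∈I
       | private-neighbour-of-cherry-leaf x₀A qA pA x₀q x₀p (p≢q ∘ sym) maxI b∈I q∈I p∈I
  ... | p′ , p′A , up′ , pp′ , p′≁x₀ | q′ , q′A , uq′ , qq′ , q′≁x₀ =
    no-A-pentagon x₀A pA p′A q′A qA x₀p pp′ p′q′ (Adj-sym qq′) (Adj-sym x₀q)
    where
    q∈I-p : q ∈ I - p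
    q∈I-p = x∈p∧x≢y⇒x∈p-y q∈I (p≢q ∘ sym)
    S₀ = (I - p) - q
    S₀⊆I : S₀ ⊆ I
    S₀⊆I = x∈p-y⇒x∈p ∘ x∈p-y⇒x∈p
    ux₀ : Undominated S₀ x₀
    ux₀ = (λ x₀∈S₀ → indI (S₀⊆I x₀∈S₀) p∈I x₀p) ,
          λ r∈S₀ x₀r → [ x∈p-y⇒x≢y (x∈p-y⇒x∈p r∈S₀) , x∈p-y⇒x≢y r∈S₀ ] (x₀-only (S₀⊆I r∈S₀) x₀r)
    S = S₀ ∪ ⁅ x₀ ⁆
    1+∣S∣≡k : suc ∣ S ∣ ≡ k
    1+∣S∣≡k = begin
      suc ∣ S ∣           ≡⟨ cong suc (x∉p⇒∣p∪⁅x⁆∣≡1+∣p∣ (proj₁ ux₀)) ⟩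
      suc (suc ∣ S₀ ∣)    ≡⟨ cong suc (x∈p⇒∣p∣≡1+∣p-x∣ q∈I-p) ⟨
      suc ∣ I - p ∣       ≡⟨ x∈p⇒∣p∣≡1+∣p-x∣ p∈I ⟨
      ∣ I ∣               ≡⟨ ∣I∣≡k ⟩
      k                   ∎
      where open Relation.Binary.PropositionalEquality.≡-Reasoning
    p′q′ : Adj G p′ q′
    p′q′ = undominated-adjacent (Indep-∪⁅⁆ (Indep-⊆ S₀⊆I indI) ux₀) 1+∣S∣≡k
      (Undominated-∪⁅⁆ (Undominated-⊆ x∈p-y⇒x∈p up′) (λ { refl → proj₂ up′ q∈I-p x₀q }) p′≁x₀)
      (Undominated-∪⁅⁆ (Undominated-⊆ (λ r∈S₀ → x∈p∧x≢y⇒x∈p-y (S₀⊆I r∈S₀) (x∈p-y⇒x≢y r∈S₀)) uq′)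
         (λ { refl → proj₂ uq′ (x∈p∧x≢y⇒x∈p-y p∈I p≢q) x₀p }) q′≁x₀)
      λ { refl → proj₂ up′ q∈I-p (Adj-sym qq′) }

  A-degree≤1 : ∀ {x₀ p q} → InA x₀ → InA p → InA q → Adj G x₀ p → Adj G x₀ q → p ≡ q
  A-degree≤1 {p = p} {q} x₀A pA qA x₀p x₀q with p ≟ q
  ... | yes p≡q = p≡q
  ... | no p≢q =
    let (I , maxI , (b∈I , p∈I , q∈I) , x₀-only) = clear-cherry x₀A pA qA x₀p x₀q p≢q in
    ⊥-elim (no-cleared-cherry x₀A pA qA x₀p x₀q p≢q maxI b∈I p∈I q∈I x₀-only)

  Matched : Subset n → Set
  Matched I = ∀ {s} → s ∈ I → s ≢ b → InA s × ∃ λ z → InA z × Adj G s z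

  -- Swapping neighbours of v₀ in I along their A-edges keeps I matched, until v₀ is undominated.
  no-matched-maximum : ∀ {I} → Maximum I → b ∈ I → Matched I → ⊥
  no-matched-maximum maxI b∈I matched =
    let (J , (maxJ , _ , matchedJ) , J∩N[v₀]≡∅) = swap-out (Nbhd v₀) P exchange maxI (b∈I , matched)
    in Maximum⇒¬Undominated maxJ (v₀∉ matchedJ , λ s∈J v₀s → J∩N[v₀]≡∅ s∈J (∈Nbhd⁺ v₀s))
    where
    P : Subset n → Set
    P I = b ∈ I × Matched I
    v₀∉ : ∀ {I} → Matched I → v₀ ∉ I
    v₀∉ matched v₀∈I = InA×InC⇒⊥ (proj₁ (matched v₀∈I (proj₁ v₀∈Gb))) v₀∈C
    exchange : ∀ {I s} → Maximum I → P I → s ∈ I → s ∈ Nbhd v₀ →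
      ∃ λ t → t ∉ Nbhd v₀ × Undominated (I - s) t × P ((I - s) ∪ ⁅ t ⁆)
    exchange {I} {s} (indI , _) (b∈I , matched) s∈I s∈N[v₀] =
      z , (λ z∈N[v₀] → Gb-triangle-free v₀∈Gb (proj₂ sA) (proj₂ zA) v₀s sz (∈Nbhd⁻ z∈N[v₀])) ,
      uz , x∈p∧x≢y⇒x∈p-y∪⁅z⁆ b∈I (s≢b ∘ sym) , matched′
      where
      v₀s = ∈Nbhd⁻ s∈N[v₀]
      s≢b : s ≢ b
      s≢b refl = proj₂ v₀∈Gb v₀s
      sA = proj₁ (matched s∈I s≢b)
      z = proj₁ (proj₂ (matched s∈I s≢b))
      zA = proj₁ (proj₂ (proj₂ (matched s∈I s≢b)))
      sz = proj₂ (proj₂ (proj₂ (matched s∈I s≢b)))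
      uz : Undominated (I - s) z
      uz = (λ z∈I-s → indI s∈I (x∈p-y⇒x∈p z∈I-s) sz) , z≁I-s
        where
        z≁I-s : ∀ {r} → r ∈ I - s → ¬ Adj G z r
        z≁I-s {r} r∈I-s zr with r ≟ b
        ... | yes refl = proj₂ (proj₂ zA) zr
        ... | no r≢b   = x∈p-y⇒x≢y r∈I-s
                           (sym (A-degree≤1 zA sA (proj₁ (matched (x∈p-y⇒x∈p r∈I-s) r≢b)) (Adj-sym sz) zr))
      matched′ : Matched ((I - s) ∪ ⁅ z ⁆)
      matched′ r∈ r≢b with x∈p∪⁅y⁆⁻ r∈
      ... | inj₁ r∈I-s = matched (x∈p-y⇒x∈p r∈I-s) r≢b
      ... | inj₂ refl  = zA , s , sA , Adj-sym sz

  clear-C : ∀ {x y u} → InA x → InA y → InA u → Adj G x y → ¬ Adj G x u → x ≢ u →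
    ∃ λ I → Maximum I × (b ∈ I × x ∈ I × u ∈ I) × (∀ {s} → s ∈ I → s ≢ b → InA s)
  clear-C {x} {y} {u} xA yA uA xy x≁u x≢u =
    let (I₀ , maxI₀ , J⊆I₀) = extend indJ
        (I , (maxI , b∈I , x∈I , u∈I) , I∩B≡∅) =
          swap-out B P exchange maxI₀ (J⊆I₀ (x∈p⇒x∈p∪⁅y⁆ (x∈p⇒x∈p∪⁅y⁆ (x∈⁅x⁆ b))) ,
                                      J⊆I₀ (x∈p⇒x∈p∪⁅y⁆ y∈p∪⁅y⁆) , J⊆I₀ y∈p∪⁅y⁆)
    in I , maxI , (b∈I , x∈I , u∈I) , λ s∈I s≢b →
         ∈Nbhd⁻ (x∉∁p⇒x∈p λ s∈∁N[a] → I∩B≡∅ s∈I (x∈p∧x≢y⇒x∈p-y s∈∁N[a] s≢b)) ,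
         member⇒InGb (proj₁ maxI) b∈I s∈I s≢b
    where
    indJ : Indep ((⁅ b ⁆ ∪ ⁅ x ⁆) ∪ ⁅ u ⁆)
    indJ = Indep-∪⁅⁆ (Indep-∪⁅⁆ Indep-⁅⁆ (Undominated-⁅⁆⁺ (proj₁ (proj₂ xA)) (proj₂ (proj₂ xA))))
             (Undominated-∪⁅⁆ (Undominated-⁅⁆⁺ (proj₁ (proj₂ uA)) (proj₂ (proj₂ uA))) (x≢u ∘ sym) (x≁u ∘ Adj-sym))
    B = ∁ (Nbhd a) - b
    P : Subset n → Set
    P I = b ∈ I × x ∈ I × u ∈ I
    exchange : ∀ {I s} → Maximum I → P I → s ∈ I → s ∈ B →
      ∃ λ t → t ∉ B × Undominated (I - s) t × P ((I - s) ∪ ⁅ t ⁆)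
    exchange {I} {s} maxI@(indI , _) (b∈I , x∈I , u∈I) s∈I s∈B =
      t , (λ t∈B → x∈∁p⇒x∉p (x∈p-y⇒x∈p t∈B) (∈Nbhd⁺ (proj₁ tA))) , ut ,
      x∈p∧x≢y⇒x∈p-y∪⁅z⁆ b∈I (s≢b ∘ sym) , x∈p∧x≢y⇒x∈p-y∪⁅z⁆ x∈I x≢s , x∈p∧x≢y⇒x∈p-y∪⁅z⁆ u∈I u≢s
      where
      s≢b = x∈p-y⇒x≢y s∈B
      sC : InC s
      sC = member⇒InGb indI b∈I s∈I s≢b , λ sa → x∈∁p⇒x∉p (x∈p-y⇒x∈p s∈B) (∈Nbhd⁺ (Adj-sym sa))
      x≢s : x ≢ s
      x≢s refl = InA×InC⇒⊥ xA sC
      u≢s : u ≢ s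
      u≢s refl = InA×InC⇒⊥ uA sC
      sy : Adj G s y
      sy = syllogismʳ (C-dominates-A-edges sC xA yA xy) (indI s∈I x∈I)
      pn = private-neighbour-in-Gb maxI b∈I s∈I s≢b
      t = proj₁ pn
      ut = proj₁ (proj₂ (proj₂ pn))
      st = proj₂ (proj₂ (proj₂ pn))
      tA : InA t
      tA with InGb⇒InA⊎InC (proj₁ (proj₂ pn))
      ... | inj₁ tA = tA
      ... | inj₂ tC = ⊥-elim (Gb-triangle-free (proj₂ yA) (proj₁ sC) (proj₁ tC) (Adj-sym sy) st (Adj-sym ty))
        where ty = syllogismʳ (C-dominates-A-edges tC xA yA xy) (proj₂ ut (x∈p∧x≢y⇒x∈p-y x∈I x≢s))

  FreeCNeighbour : Fin n → Subset n → Fin n → Set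
  FreeCNeighbour t D v = InC v × Adj G t v × Undominated D v

  private-neighbour-in-C : ∀ {B₀ t σ τ} → Indep B₀ → suc (suc ∣ B₀ ∣) ≡ k → b ∈ B₀ → t ∈ B₀ → t ≢ b →
    (∀ {z} → InA z → ¬ Adj G t z) → Undominated B₀ σ → Undominated B₀ τ → σ ≢ τ → ¬ Adj G σ τ →
    ∃ λ v → FreeCNeighbour t (B₀ - t) v × ¬ Adj G v σ × ¬ Adj G v τ
  private-neighbour-in-C {B₀} {t} {σ} {τ} indB₀ 2+∣B₀∣≡k b∈B₀ t∈B₀ t≢b t≁A uσ uτ σ≢τ σ≁τ =
    v , (vC , tv , Undominated-⊆ B₀-t⊆I′-t uv) , proj₂ uv σ∈I′-t , proj₂ uv τ∈I′-t
    where
    I′ = (B₀ ∪ ⁅ σ ⁆) ∪ ⁅ τ ⁆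
    uτ′ : Undominated (B₀ ∪ ⁅ σ ⁆) τ
    uτ′ = Undominated-∪⁅⁆ uτ (σ≢τ ∘ sym) (σ≁τ ∘ Adj-sym)
    maxI′ : Maximum I′
    maxI′ = Indep-∪⁅⁆ (Indep-∪⁅⁆ indB₀ uσ) uτ′ ,
            trans (x∉p⇒∣p∪⁅x⁆∣≡1+∣p∣ (proj₁ uτ′)) (trans (cong suc (x∉p⇒∣p∪⁅x⁆∣≡1+∣p∣ (proj₁ uσ))) 2+∣B₀∣≡k)
    B₀⊆I′ : B₀ ⊆ I′
    B₀⊆I′ = x∈p⇒x∈p∪⁅y⁆ ∘ x∈p⇒x∈p∪⁅y⁆
    pn = private-neighbour-in-Gb maxI′ (B₀⊆I′ b∈B₀) (B₀⊆I′ t∈B₀) t≢b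
    v = proj₁ pn
    uv = proj₁ (proj₂ (proj₂ pn))
    tv = proj₂ (proj₂ (proj₂ pn))
    vC : InC v
    vC = syllogismʳ (InGb⇒InA⊎InC (proj₁ (proj₂ pn))) λ vA → t≁A vA tv
    B₀-t⊆I′-t : B₀ - t ⊆ I′ - t
    B₀-t⊆I′-t r∈ = x∈p∧x≢y⇒x∈p-y (B₀⊆I′ (x∈p-y⇒x∈p r∈)) (x∈p-y⇒x≢y r∈)
    σ∈I′-t : σ ∈ I′ - t
    σ∈I′-t = x∈p∧x≢y⇒x∈p-y (x∈p⇒x∈p∪⁅y⁆ y∈p∪⁅y⁆) λ { refl → proj₁ uσ t∈B₀ }
    τ∈I′-t : τ ∈ I′ - t
    τ∈I′-t = x∈p∧x≢y⇒x∈p-y y∈p∪⁅y⁆ λ { refl → proj₁ uτ t∈B₀ }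

  no-four-free-C-neighbours : ∀ {D t v₁ v₂ v₃ v₄} → Indep D → suc (suc (suc ∣ D ∣)) ≡ k → InGb t →
    FreeCNeighbour t D v₁ → FreeCNeighbour t D v₂ → FreeCNeighbour t D v₃ → FreeCNeighbour t D v₄ →
    v₂ ≢ v₁ → v₃ ≢ v₁ → v₃ ≢ v₂ → v₄ ≢ v₁ → v₄ ≢ v₂ → v₄ ≢ v₃ → ⊥
  no-four-free-C-neighbours {D} {t} {v₁} {v₂} {v₃} {v₄} indD 3+∣D∣≡k t∈Gb f₁ f₂ f₃ f₄ v₂≢v₁ v₃≢v₁ v₃≢v₂ v₄≢v₁ v₄≢v₂ v₄≢v₃ =
    <⇒≢ (Undominated⇒∣S∣<α (Indep-∪⁅⁆ (Indep-∪⁅⁆ (Indep-∪⁅⁆ indD (proj₂ (proj₂ f₁))) u₂) u₃) u₄) ∣R₃∣≡k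
    where
    ≁ : ∀ {v v′} → FreeCNeighbour t D v → FreeCNeighbour t D v′ → ¬ Adj G v v′
    ≁ (vC , tv , _) (v′C , tv′ , _) vv′ = Gb-triangle-free t∈Gb (proj₁ vC) (proj₁ v′C) tv vv′ tv′
    u₂ : Undominated (D ∪ ⁅ v₁ ⁆) v₂
    u₂ = Undominated-∪⁅⁆ (proj₂ (proj₂ f₂)) v₂≢v₁ (≁ f₂ f₁)
    u₃ : Undominated ((D ∪ ⁅ v₁ ⁆) ∪ ⁅ v₂ ⁆) v₃
    u₃ = Undominated-∪⁅⁆ (Undominated-∪⁅⁆ (proj₂ (proj₂ f₃)) v₃≢v₁ (≁ f₃ f₁)) v₃≢v₂ (≁ f₃ f₂)
    u₄ : Undominated (((D ∪ ⁅ v₁ ⁆) ∪ ⁅ v₂ ⁆) ∪ ⁅ v₃ ⁆) v₄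
    u₄ = Undominated-∪⁅⁆ (Undominated-∪⁅⁆ (Undominated-∪⁅⁆ (proj₂ (proj₂ f₄)) v₄≢v₁ (≁ f₄ f₁))
           v₄≢v₂ (≁ f₄ f₂)) v₄≢v₃ (≁ f₄ f₃)
    ∣R₃∣≡k : ∣ ((D ∪ ⁅ v₁ ⁆) ∪ ⁅ v₂ ⁆) ∪ ⁅ v₃ ⁆ ∣ ≡ k
    ∣R₃∣≡k = trans (x∉p⇒∣p∪⁅x⁆∣≡1+∣p∣ (proj₁ u₃))
               (trans (cong suc (x∉p⇒∣p∪⁅x⁆∣≡1+∣p∣ (proj₁ u₂)))
                 (trans (cong (λ m → suc (suc m)) (x∉p⇒∣p∪⁅x⁆∣≡1+∣p∣ (proj₁ (proj₂ (proj₂ f₁))))) 3+∣D∣≡k))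

  partner-undominated : ∀ {I x y} → Indep I → (∀ {s} → s ∈ I → s ≢ b → InA s) →
    x ∈ I → InA x → InA y → Adj G x y → Undominated (I - x) y
  partner-undominated {I} {x} {y} indI I∖b⊆A x∈I xA yA xy = (λ y∈I-x → indI x∈I (x∈p-y⇒x∈p y∈I-x) xy) , y≁I-x
    where
    y≁I-x : ∀ {r} → r ∈ I - x → ¬ Adj G y r
    y≁I-x {r} r∈I-x yr with r ≟ b
    ... | yes refl = proj₂ (proj₂ yA) yr
    ... | no r≢b   = x∈p-y⇒x≢y r∈I-x
                       (sym (A-degree≤1 yA xA (I∖b⊆A (x∈p-y⇒x∈p r∈I-x) r≢b) (Adj-sym xy) yr))

  -- For each choice of an end of xy and an end of uw, t has a private C-neighbour avoiding both;
  -- these four are distinct, pairwise nonadjacent and undominated by I - x - u - t: one too many.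
  no-isolated-A-member : ∀ {x y u w I t} → InA x → InA y → InA u → InA w → Adj G x y → Adj G u w →
    u ≢ x → u ≢ y → w ≢ x → w ≢ y → Maximum I → b ∈ I → x ∈ I → u ∈ I → (∀ {s} → s ∈ I → s ≢ b → InA s) →
    t ∈ I → t ≢ b → (∀ {z} → InA z → ¬ Adj G t z) → ⊥
  no-isolated-A-member {x} {y} {u} {w} {I} {t} xA yA uA wA xy uw u≢x u≢y w≢x w≢y (indI , ∣I∣≡k)
                       b∈I x∈I u∈I I∖b⊆A t∈I t≢b t≁A =
    four (avoiding x-free u-free u≢x (indI x∈I u∈I))
         (avoiding x-free w-free w≢x (beyond xA yA wA xy w≢y))
         (avoiding y-free u-free u≢y (beyond yA xA uA (Adj-sym xy) u≢x))
         (avoiding y-free w-free w≢y (beyond yA xA wA (Adj-sym xy) w≢x))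
    where
    B₀ = (I - x) - u
    B₀⊆I : B₀ ⊆ I
    B₀⊆I = x∈p-y⇒x∈p ∘ x∈p-y⇒x∈p
    B₀⊆I-u : B₀ ⊆ I - u
    B₀⊆I-u r∈B₀ = x∈p∧x≢y⇒x∈p-y (B₀⊆I r∈B₀) (x∈p-y⇒x≢y r∈B₀)
    2+∣B₀∣≡k : suc (suc ∣ B₀ ∣) ≡ k
    2+∣B₀∣≡k = trans (cong suc (sym (x∈p⇒∣p∣≡1+∣p-x∣ (x∈p∧x≢y⇒x∈p-y u∈I u≢x))))
                 (trans (sym (x∈p⇒∣p∣≡1+∣p-x∣ x∈I)) ∣I∣≡k)
    in-B₀ : ∀ {r} → r ∈ I → r ≢ x → r ≢ u → r ∈ B₀
    in-B₀ r∈I r≢x r≢u = x∈p∧x≢y⇒x∈p-y (x∈p∧x≢y⇒x∈p-y r∈I r≢x) r≢u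
    t∈B₀ : t ∈ B₀
    t∈B₀ = in-B₀ t∈I (λ { refl → t≁A yA xy }) (λ { refl → t≁A wA uw })
    x-free : Undominated B₀ x
    x-free = Undominated-⊆ x∈p-y⇒x∈p (removed-undominated indI x∈I)
    u-free : Undominated B₀ u
    u-free = Undominated-⊆ B₀⊆I-u (removed-undominated indI u∈I)
    y-free : Undominated B₀ y
    y-free = Undominated-⊆ x∈p-y⇒x∈p (partner-undominated indI I∖b⊆A x∈I xA yA xy)
    w-free : Undominated B₀ w
    w-free = Undominated-⊆ B₀⊆I-u (partner-undominated indI I∖b⊆A u∈I uA wA uw)
    beyond : ∀ {σ σ′ τ} → InA σ → InA σ′ → InA τ → Adj G σ σ′ → τ ≢ σ′ → ¬ Adj G σ τ
    beyond σA σ′A τA σσ′ τ≢σ′ στ = τ≢σ′ (sym (A-degree≤1 σA σ′A τA σσ′ στ))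
    Avoiding : Fin n → Fin n → Set
    Avoiding σ τ = ∃ λ v → FreeCNeighbour t (B₀ - t) v × ¬ Adj G v σ × ¬ Adj G v τ
    avoiding : ∀ {σ τ} → Undominated B₀ σ → Undominated B₀ τ → τ ≢ σ → ¬ Adj G σ τ → Avoiding σ τ
    avoiding uσ uτ τ≢σ σ≁τ =
      private-neighbour-in-C (Indep-⊆ B₀⊆I indI) 2+∣B₀∣≡k (in-B₀ b∈I (proj₁ (proj₂ xA) ∘ sym) (proj₁ (proj₂ uA) ∘ sym))
        t∈B₀ t≢b t≁A uσ uτ (τ≢σ ∘ sym) σ≁τ
    separated : ∀ {v v′ z} → ¬ Adj G v z → Adj G v′ z → v′ ≢ v
    separated v≁z v′z refl = v≁z v′z
    adjacent-x : ∀ {D v} → FreeCNeighbour t D v → ¬ Adj G v y → Adj G v x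
    adjacent-x (vC , _) = syllogismˡ (C-dominates-A-edges vC xA yA xy)
    adjacent-u : ∀ {D v} → FreeCNeighbour t D v → ¬ Adj G v w → Adj G v u
    adjacent-u (vC , _) = syllogismˡ (C-dominates-A-edges vC uA wA uw)
    four : Avoiding x u → Avoiding x w → Avoiding y u → Avoiding y w → ⊥
    four (v₁ , f₁ , v₁≁x , v₁≁u) (v₂ , f₂ , v₂≁x , v₂≁w) (v₃ , f₃ , v₃≁y , v₃≁u) (v₄ , f₄ , v₄≁y , v₄≁w) =
      no-four-free-C-neighbours (Indep-⊆ (B₀⊆I ∘ x∈p-y⇒x∈p) indI)
        (trans (cong (λ m → suc (suc m)) (sym (x∈p⇒∣p∣≡1+∣p-x∣ t∈B₀))) 2+∣B₀∣≡k)
        (member⇒InGb indI b∈I t∈I t≢b) f₁ f₂ f₃ f₄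
        (separated v₁≁u (adjacent-u f₂ v₂≁w)) (separated v₁≁x (adjacent-x f₃ v₃≁y))
        (separated v₂≁x (adjacent-x f₃ v₃≁y)) (separated v₁≁x (adjacent-x f₄ v₄≁y))
        (separated v₂≁x (adjacent-x f₄ v₄≁y)) (separated v₃≁u (adjacent-u f₄ v₄≁w))

  has-A-neighbour? : ∀ t → Dec (∃ λ z → InA z × Adj G t z)
  has-A-neighbour? t = any? λ z → InA? z ×-dec Adj? t z

  isolated-or-matched : ∀ I → (∀ {s} → s ∈ I → s ≢ b → InA s) →
    (∃ λ t → t ∈ I × t ≢ b × ∀ {z} → InA z → ¬ Adj G t z) ⊎ Matched I
  isolated-or-matched I I∖b⊆A with any? (λ t → t ∈? I ×-dec (¬? (t ≟ b) ×-dec ¬? (has-A-neighbour? t)))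
  ... | yes (t , t∈I , t≢b , isolated) = inj₁ (t , t∈I , t≢b , λ zA tz → isolated (_ , zA , tz))
  ... | no none = inj₂ λ s∈I s≢b → I∖b⊆A s∈I s≢b , partner s∈I s≢b
    where
    partner : ∀ {s} → s ∈ I → s ≢ b → ∃ λ z → InA z × Adj G s z
    partner {s} s∈I s≢b with has-A-neighbour? s
    ... | yes nbr = nbr
    ... | no ¬nbr = contradiction (s , s∈I , s≢b , ¬nbr) none

  A-edges-meet : ∀ {x y u w} → InA x → InA y → InA u → InA w → Adj G x y → Adj G u w →
    u ≢ x → u ≢ y → w ≢ x → w ≢ y → ⊥
  A-edges-meet xA yA uA wA xy uw u≢x u≢y w≢x w≢y =
    let (I , maxI , (b∈I , x∈I , u∈I) , I∖b⊆A) =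
          clear-C xA yA uA xy (λ xu → u≢y (sym (A-degree≤1 xA yA uA xy xu))) (u≢x ∘ sym)
    in [ (λ (t , t∈I , t≢b , t≁A) →
                     no-isolated-A-member xA yA uA wA xy uw u≢x u≢y w≢x w≢y maxI b∈I x∈I u∈I I∖b⊆A t∈I t≢b t≁A) ,
                  no-matched-maximum maxI b∈I ]
                (isolated-or-matched I I∖b⊆A)

  A-edge-unique : ∀ {x y u w} → InA x → InA y → Adj G x y → InA u → InA w → Adj G u w →
    (u ≡ x × w ≡ y) ⊎ (u ≡ y × w ≡ x)
  A-edge-unique {x} {y} {u} {w} xA yA xy uA wA uw with u ≟ x | u ≟ y
  ... | yes refl | _        = inj₁ (refl , A-degree≤1 xA wA yA uw xy)
  ... | no _     | yes refl = inj₂ (refl , A-degree≤1 yA wA xA uw (Adj-sym xy))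
  ... | no u≢x   | no u≢y with w ≟ x | w ≟ y
  ...   | yes refl | _        = ⊥-elim (u≢y (A-degree≤1 xA uA yA (Adj-sym uw) xy))
  ...   | no _     | yes refl = ⊥-elim (u≢x (A-degree≤1 yA uA xA (Adj-sym uw) (Adj-sym xy)))
  ...   | no w≢x   | no w≢y   = ⊥-elim (A-edges-meet xA yA uA wA xy uw u≢x u≢y w≢x w≢y)

  module Counting {x y : Fin n} (xA : InA x) (yA : InA y) (xy : Adj G x y) where

    W : Subset n
    W = Aset G a b - x - y

    ∈W⁻ : ∀ {w} → w ∈ W → InA w × w ≢ x × w ≢ y
    ∈W⁻ w∈W = ∈Aset⇒InA (x∈p-y⇒x∈p (x∈p-y⇒x∈p w∈W)) , x∈p-y⇒x≢y (x∈p-y⇒x∈p w∈W) , x∈p-y⇒x≢y w∈W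

    W-isolated : ∀ {w z} → w ∈ W → InA z → ¬ Adj G w z
    W-isolated w∈W zA wz with ∈W⁻ w∈W
    ... | wA , w≢x , w≢y = [ w≢x ∘ proj₁ , w≢y ∘ proj₁ ] (A-edge-unique xA yA xy wA zA wz)

    J : Subset n
    J = (W ∪ ⁅ b ⁆) ∪ ⁅ x ⁆

    ∈J⁻ : ∀ {s} → s ∈ J → (s ∈ W ⊎ s ≡ b) ⊎ s ≡ x
    ∈J⁻ s∈J = map₁ x∈p∪⁅y⁆⁻ (x∈p∪⁅y⁆⁻ s∈J)

    W⊆J : W ⊆ J
    W⊆J = x∈p⇒x∈p∪⁅y⁆ ∘ x∈p⇒x∈p∪⁅y⁆

    b∈J : b ∈ J
    b∈J = x∈p⇒x∈p∪⁅y⁆ y∈p∪⁅y⁆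

    x∈J : x ∈ J
    x∈J = y∈p∪⁅y⁆

    b-free : Undominated W b
    b-free = (λ b∈W → proj₁ (proj₂ (proj₁ (∈W⁻ b∈W))) refl) , λ w∈W wb → proj₂ (proj₂ (proj₁ (∈W⁻ w∈W))) (Adj-sym wb)

    x-free : Undominated (W ∪ ⁅ b ⁆) x
    x-free = Undominated-∪⁅⁆ ((λ x∈W → proj₁ (proj₂ (∈W⁻ x∈W)) refl) , λ w∈W xw → W-isolated w∈W xA (Adj-sym xw))
               (proj₁ (proj₂ xA)) (proj₂ (proj₂ xA))

    indJ : Indep J
    indJ = Indep-∪⁅⁆ (Indep-∪⁅⁆ (λ w∈W w′∈W → W-isolated w∈W (proj₁ (∈W⁻ w′∈W))) b-free) x-free

    ∣J∣≡2+∣W∣ : ∣ J ∣ ≡ suc (suc ∣ W ∣)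
    ∣J∣≡2+∣W∣ = trans (x∉p⇒∣p∪⁅x⁆∣≡1+∣p∣ (proj₁ x-free)) (cong suc (x∉p⇒∣p∪⁅x⁆∣≡1+∣p∣ (proj₁ b-free)))

    C∉J : ∀ {v} → InC v → v ∉ J
    C∉J vC v∈J with ∈J⁻ v∈J
    ... | inj₁ (inj₁ v∈W) = InA×InC⇒⊥ (proj₁ (∈W⁻ v∈W)) vC
    ... | inj₁ (inj₂ refl) = proj₁ (proj₁ vC) refl
    ... | inj₂ refl = InA×InC⇒⊥ xA vC

    J-maximal : ∀ {z} → ¬ Undominated J z
    J-maximal {z} uz@(z∉J , z≁J) with InGb⇒InA⊎InC (undominated⇒InGb b∈J uz)
    ... | inj₁ zA with z ≟ x | z ≟ y
    ...   | yes refl | _        = z∉J x∈J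
    ...   | no _     | yes refl = z≁J x∈J (Adj-sym xy)
    ...   | no z≢x   | no z≢y   = z∉J (W⊆J (x∈p∧x≢y⇒x∈p-y (x∈p∧x≢y⇒x∈p-y (InA⇒∈Aset zA) z≢x) z≢y))
    J-maximal {z} uz | inj₂ zC =
      let (I , maxI , J∪z⊆I) = extend (Indep-∪⁅⁆ indJ uz) in
      no-C-extension zC uz maxI (J∪z⊆I ∘ x∈p⇒x∈p∪⁅y⁆) (J∪z⊆I y∈p∪⁅y⁆)
      where
      no-C-extension : ∀ {z I} → InC z → Undominated J z → Maximum I → J ⊆ I → z ∈ I → ⊥
      no-C-extension {z} {I} zC (z∉J , z≁J) maxI J⊆I z∈I with private-neighbour-in-Gb maxI (J⊆I b∈J) z∈I (proj₁ (proj₁ zC))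
      ... | t , t∈Gb , (t∉I-z , t≁I-z) , zt with InGb⇒InA⊎InC t∈Gb
      ...   | inj₁ tA = t∉I-z (x∈p∧x≢y⇒x∈p-y (J⊆I (W⊆J t∈W)) λ { refl → t∉I-z (x∈p∧x≢y⇒x∈p-y z∈I (Adj⇒≢ zt)) })
        where
        x∈I-z : x ∈ I - z
        x∈I-z = x∈p∧x≢y⇒x∈p-y (J⊆I x∈J) λ { refl → z∉J x∈J }
        t∈W : t ∈ W
        t∈W = x∈p∧x≢y⇒x∈p-y (x∈p∧x≢y⇒x∈p-y (InA⇒∈Aset tA) λ { refl → t∉I-z x∈I-z })
                λ { refl → t≁I-z x∈I-z (Adj-sym xy) }
      ...   | inj₂ tC = Gb-triangle-free (proj₂ yA) (proj₁ zC) (proj₁ tC) (Adj-sym zy) zt (Adj-sym ty)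
        where
        zy = syllogismʳ (C-dominates-A-edges zC xA yA xy) (z≁J x∈J)
        ty = syllogismʳ (C-dominates-A-edges tC xA yA xy)
               (t≁I-z (x∈p∧x≢y⇒x∈p-y (J⊆I x∈J) λ { refl → z∉J x∈J }))

    J-dominating : Dominating (V G) J
    J-dominating {z} _ z∉J with dominated? J z
    ... | yes dom = dom
    ... | no ¬dom = ⊥-elim (J-maximal (z∉J , λ s∈J zs → ¬dom (_ , s∈J , zs)))

    maxJ : Maximum J
    maxJ = indJ , Dominating⇒∣S∣≡α α (proj₁ w2) (Indep⇒Independent indJ) J-dominating

    k≡2+∣W∣ : k ≡ suc (suc ∣ W ∣)
    k≡2+∣W∣ = trans (sym (proj₂ maxJ)) ∣J∣≡2+∣W∣

    Q : Subset n
    Q = Gab G a b ∩ Nbhd y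

    ∈Q⁺ : ∀ {v} → InC v → Adj G v y → v ∈ Q
    ∈Q⁺ vC vy = x∈p∩q⁺ (InC⇒∈Gab vC , ∈Nbhd⁺ (Adj-sym vy))

    ∈Q⁻ : ∀ {v} → v ∈ Q → InC v × Adj G v y
    ∈Q⁻ v∈Q = ∈Gab⇒InC (proj₁ (x∈p∩q⁻ _ _ v∈Q)) , Adj-sym (∈Nbhd⁻ (proj₂ (x∈p∩q⁻ _ _ v∈Q)))

    Q-independent : ∀ {v v′} → v ∈ Q → v′ ∈ Q → ¬ Adj G v v′
    Q-independent v∈Q v′∈Q vv′ =
      Gb-triangle-free (proj₂ yA) (proj₁ (proj₁ (∈Q⁻ v∈Q))) (proj₁ (proj₁ (∈Q⁻ v′∈Q)))
        (Adj-sym (proj₂ (∈Q⁻ v∈Q))) vv′ (Adj-sym (proj₂ (∈Q⁻ v′∈Q)))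

    Q-neighbour-in-J⇒∈W : ∀ {v s} → v ∈ Q → s ∈ J → Adj G v s → s ∈ W
    Q-neighbour-in-J⇒∈W v∈Q s∈J vs with ∈Q⁻ v∈Q | ∈J⁻ s∈J
    ... | _                    | inj₁ (inj₁ s∈W)  = s∈W
    ... | ((_ , v≁b) , _) , _  | inj₁ (inj₂ refl) = ⊥-elim (v≁b vs)
    ... | (v∈Gb , _) , vy      | inj₂ refl        = ⊥-elim (Gb-triangle-free v∈Gb (proj₂ xA) (proj₂ yA) vs xy vy)

    Q-neighbour-in-W : ∀ {v} → v ∈ Q → ∃ λ w → w ∈ W × Adj G v w
    Q-neighbour-in-W v∈Q =
      let (s , s∈J , vs) = J-dominating ∈V (C∉J (proj₁ (∈Q⁻ v∈Q))) in
      s , Q-neighbour-in-J⇒∈W v∈Q s∈J vs , vs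

    -- Opaque: with-abstracting over this witness would otherwise unfold the whole search behind it.
    opaque
      W-private-neighbour : ∀ {w} → w ∈ W → ∃ λ q → q ∈ Q × Adj G w q × Undominated (J - w) q
      W-private-neighbour {w} w∈W with ∈W⁻ w∈W
      ... | (_ , w≢b , _) , w≢x , _ with private-neighbour-in-Gb maxJ b∈J (W⊆J w∈W) w≢b
      ...   | q , q∈Gb , uq , wq = q , ∈Q⁺ qC qy , wq , uq
        where
        qC : InC q
        qC = syllogismʳ (InGb⇒InA⊎InC q∈Gb) λ qA → W-isolated w∈W qA wq
        qy : Adj G q y
        qy = syllogismʳ (C-dominates-A-edges qC xA yA xy) (proj₂ uq (x∈p∧x≢y⇒x∈p-y x∈J (w≢x ∘ sym)))

    -- Otherwise swapping the W-neighbours of v for their private neighbours in Q frees v.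
    Q-neighbour-in-W-unique : ∀ {v w₁ w₂} → v ∈ Q → w₁ ∈ W → w₂ ∈ W → Adj G v w₁ → Adj G v w₂ → w₁ ≡ w₂
    Q-neighbour-in-W-unique {v} {w₁} {w₂} v∈Q w₁∈W w₂∈W vw₁ vw₂ with w₁ ≟ w₂
    ... | yes w₁≡w₂ = w₁≡w₂
    ... | no w₁≢w₂ =
      let (I , (maxI , v∉I , _) , I∩N[v]≡∅) = swap-out (Nbhd v) P exchange maxJ (C∉J (proj₁ (∈Q⁻ v∈Q)) , x∈p∪q⁺ ∘ inj₁)
      in ⊥-elim (Maximum⇒¬Undominated maxI (v∉I , λ s∈I vs → I∩N[v]≡∅ s∈I (∈Nbhd⁺ vs)))
      where
      P : Subset n → Set
      P I = v ∉ I × I ⊆ J ∪ Q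
      exchange : ∀ {I r} → Maximum I → P I → r ∈ I → r ∈ Nbhd v →
        ∃ λ t → t ∉ Nbhd v × Undominated (I - r) t × P ((I - r) ∪ ⁅ t ⁆)
      exchange {I} {r} (indI , _) (v∉I , I⊆J∪Q) r∈I r∈N[v] with x∈p∪q⁻ J Q (I⊆J∪Q r∈I)
      ... | inj₂ r∈Q = ⊥-elim (Q-independent v∈Q r∈Q (∈Nbhd⁻ r∈N[v]))
      ... | inj₁ r∈J with W-private-neighbour (Q-neighbour-in-J⇒∈W v∈Q r∈J (∈Nbhd⁻ r∈N[v]))
      ...   | q , q∈Q , rq , (q∉J-r , q≁J-r) =
        q , (λ q∈N[v] → Q-independent v∈Q q∈Q (∈Nbhd⁻ q∈N[v])) ,
        ((λ q∈I-r → indI r∈I (x∈p-y⇒x∈p q∈I-r) rq) , q≁I-r) , v∉I′ , I′⊆J∪Q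
        where
        q≁I-r : ∀ {r′} → r′ ∈ I - r → ¬ Adj G q r′
        q≁I-r r′∈I-r with x∈p∪q⁻ J Q (I⊆J∪Q (x∈p-y⇒x∈p r′∈I-r))
        ... | inj₁ r′∈J = q≁J-r (x∈p∧x≢y⇒x∈p-y r′∈J (x∈p-y⇒x≢y r′∈I-r))
        ... | inj₂ r′∈Q = Q-independent q∈Q r′∈Q
        v∉I′ : v ∉ (I - r) ∪ ⁅ q ⁆
        v∉I′ v∈I′ with x∈p∪⁅y⁆⁻ v∈I′
        ... | inj₁ v∈I-r = v∉I (x∈p-y⇒x∈p v∈I-r)
        ... | inj₂ refl with w₁ ≟ r
        ...   | yes refl = q≁J-r (x∈p∧x≢y⇒x∈p-y (W⊆J w₂∈W) (w₁≢w₂ ∘ sym)) vw₂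
        ...   | no w₁≢r  = q≁J-r (x∈p∧x≢y⇒x∈p-y (W⊆J w₁∈W) w₁≢r) vw₁
        I′⊆J∪Q : (I - r) ∪ ⁅ q ⁆ ⊆ J ∪ Q
        I′⊆J∪Q r′∈I′ with x∈p∪⁅y⁆⁻ r′∈I′
        ... | inj₁ r′∈I-r = I⊆J∪Q (x∈p-y⇒x∈p r′∈I-r)
        ... | inj₂ refl   = x∈p∪q⁺ (inj₂ q∈Q)

    W-neighbour-in-Q-unique : ∀ {w v} (w∈W : w ∈ W) → v ∈ Q → Adj G v w → v ≡ proj₁ (W-private-neighbour w∈W)
    W-neighbour-in-Q-unique {w} {v} w∈W v∈Q vw with W-private-neighbour w∈W | v ≟ proj₁ (W-private-neighbour w∈W)
    ... | _ | yes v≡q = v≡q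
    ... | q , q∈Q , wq , uq | no v≢q = ⊥-elim (no-three-undominated ltf
            (Indep-⊆ x∈p-y⇒x∈p indJ) (trans (sym (x∈p⇒∣p∣≡1+∣p-x∣ w∈J)) (proj₂ maxJ))
            (x∈p∧x≢y⇒x∈p-y b∈J (proj₁ (proj₂ (proj₁ (∈W⁻ w∈W))) ∘ sym))
            (removed-undominated indJ w∈J) uv uq
            (λ { refl → InA×InC⇒⊥ (proj₁ (∈W⁻ w∈W)) (proj₁ (∈Q⁻ v∈Q)) }) v≢q (Adj⇒≢ wq))
      where
      w∈J = W⊆J w∈W
      uv : Undominated (J - w) v
      uv = C∉J (proj₁ (∈Q⁻ v∈Q)) ∘ x∈p-y⇒x∈p ,
           λ r∈J-w vr → x∈p-y⇒x≢y r∈J-w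
             (Q-neighbour-in-W-unique v∈Q (Q-neighbour-in-J⇒∈W v∈Q (x∈p-y⇒x∈p r∈J-w) vr) w∈W vr vw)

    ∣Q∣≡∣W∣ : ∣ Q ∣ ≡ ∣ W ∣
    ∣Q∣≡∣W∣ = Matching⇒∣p∣≡∣q∣ record
      { partnerˡ = Q-neighbour-in-W
      ; partnerʳ = λ w∈W → let (q , q∈Q , wq , _) = W-private-neighbour w∈W in q , q∈Q , Adj-sym wq
      ; uniqueˡ  = Q-neighbour-in-W-unique
      ; uniqueʳ  = λ v∈Q v′∈Q w∈W vw v′w →
          trans (W-neighbour-in-Q-unique w∈W v∈Q vw) (sym (W-neighbour-in-Q-unique w∈W v′∈Q v′w))
      }

  module _ {x y : Fin n} (xA : InA x) (yA : InA y) (xy : Adj G x y) where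
    private
      module Cxy = Counting xA yA xy
      module Cyx = Counting yA xA (Adj-sym xy)

    ∣Aset∣≡2+∣W∣ : ∣ Aset G a b ∣ ≡ suc (suc ∣ Cxy.W ∣)
    ∣Aset∣≡2+∣W∣ =
      trans (x∈p⇒∣p∣≡1+∣p-x∣ (InA⇒∈Aset xA))
            (cong suc (x∈p⇒∣p∣≡1+∣p-x∣ (x∈p∧x≢y⇒x∈p-y (InA⇒∈Aset yA) (Adj⇒≢ xy ∘ sym))))

    ∣Gab∣≡2∣W∣ : ∣ Gab G a b ∣ ≡ 2 * ∣ Cxy.W ∣
    ∣Gab∣≡2∣W∣ = begin
      ∣ Gab G a b ∣           ≡⟨ cong ∣_∣ (⊆-antisym Gab⊆Q∪Q′ Q∪Q′⊆Gab) ⟩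
      ∣ Cxy.Q ∪ Cyx.Q ∣       ≡⟨ ∣p∪q∣≡∣p∣+∣q∣ Cxy.Q Cyx.Q disjoint ⟩
      ∣ Cxy.Q ∣ + ∣ Cyx.Q ∣   ≡⟨ cong₂ _+_ Cxy.∣Q∣≡∣W∣ Cyx.∣Q∣≡∣W∣ ⟩
      ∣ Cxy.W ∣ + ∣ Cyx.W ∣   ≡⟨ cong (λ W′ → ∣ Cxy.W ∣ + ∣ W′ ∣) (p─x─y≡p─y─x (Aset G a b) y x) ⟩
      ∣ Cxy.W ∣ + ∣ Cxy.W ∣   ≡⟨ cong (∣ Cxy.W ∣ +_) (+-identityʳ ∣ Cxy.W ∣) ⟨
      2 * ∣ Cxy.W ∣           ∎
      where
      open Relation.Binary.PropositionalEquality.≡-Reasoning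
      Gab⊆Q∪Q′ : Gab G a b ⊆ Cxy.Q ∪ Cyx.Q
      Gab⊆Q∪Q′ v∈Gab with C-dominates-A-edges (∈Gab⇒InC v∈Gab) xA yA xy
      ... | inj₁ vx = x∈p∪q⁺ (inj₂ (Cyx.∈Q⁺ (∈Gab⇒InC v∈Gab) vx))
      ... | inj₂ vy = x∈p∪q⁺ (inj₁ (Cxy.∈Q⁺ (∈Gab⇒InC v∈Gab) vy))
      Q∪Q′⊆Gab : Cxy.Q ∪ Cyx.Q ⊆ Gab G a b
      Q∪Q′⊆Gab v∈ = [ (λ v∈Q → proj₁ (x∈p∩q⁻ _ _ v∈Q)) , (λ v∈Q′ → proj₁ (x∈p∩q⁻ _ _ v∈Q′)) ]
                      (x∈p∪q⁻ Cxy.Q Cyx.Q v∈)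
      disjoint : ∀ {v} → v ∈ Cxy.Q → v ∉ Cyx.Q
      disjoint v∈Q v∈Q′ = Gb-triangle-free (proj₁ (proj₁ (Cxy.∈Q⁻ v∈Q))) (proj₂ xA) (proj₂ yA)
                            (proj₂ (Cyx.∈Q⁻ v∈Q′)) xy (proj₂ (Cxy.∈Q⁻ v∈Q))

lemma2p1 : ∀ {n} (G : Graph n) (k : ℕ) → IsAlpha G (V G) k →
  LocallyTriangleFree G → InW2 G → 3 ≤ k →
  (a b c : Fin n) → Adj G a b → Adj G b c → Adj G a c →
  (∃ λ v → v ∈ Gab G a b) →
  (Σ (Fin n) λ x → Σ (Fin n) λ y → x ∈ Aset G a b × y ∈ Aset G a b × Adj G x y) →
  ((Σ (Fin n) λ x → Σ (Fin n) λ y → x ∈ Aset G a b × y ∈ Aset G a b × Adj G x y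
      × (∀ u w → u ∈ Aset G a b → w ∈ Aset G a b → Adj G u w →
           (u ≡ x × w ≡ y) ⊎ (u ≡ y × w ≡ x)))
    × ∣ Aset G a b ∣ ≡ 2 + (k ∸ 2))
  × ∣ Gab G a b ∣ ≡ 2 * (k ∸ 2)
lemma2p1 G k α ltf w2 _ a b _ ab _ _ (_ , v₀∈Gab) (x , y , x∈A , y∈A , xy) =
  ((x , y , x∈A , y∈A , xy , λ u w u∈A w∈A uw → A-edge-unique xA yA xy (∈Aset⇒InA u∈A) (∈Aset⇒InA w∈A) uw) ,
   trans (∣Aset∣≡2+∣W∣ xA yA xy) (cong (2 +_) (sym k∸2≡∣W∣))) ,
  trans (∣Gab∣≡2∣W∣ xA yA xy) (cong (2 *_) (sym k∸2≡∣W∣))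
  where
  open AroundEdge G α ltf w2 ab v₀∈Gab
  xA = ∈Aset⇒InA x∈A
  yA = ∈Aset⇒InA y∈A
  k∸2≡∣W∣ : k ∸ 2 ≡ ∣ Counting.W xA yA xy ∣
  k∸2≡∣W∣ = cong (_∸ 2) (Counting.k≡2+∣W∣ xA yA xy)
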